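{- Let $G$ be a finite group acting on a finite set $X$ with orbits $X_1,\dots,X_k$, such that every nontrivial normal subgroup $N$ of $G$ is transitive on all but at most one of the $G$-orbits. Then $G$ is quasiprimitive on all but at most one of the $G$-faithful orbits.
   Context: A $G$-orbit $X_i$ is $G$-faithful if the kernel of the action of $G$ on $X_i$ is trivial. $G$ is quasiprimitive on $X_i$ if every nontrivial normal subgroup of the induced group $G^{X_i}$ is transitive on $X_i$. -}

module Defs where

open import Level using (Level; _⊔_)
open import Data.Nat using (ℕ)
open import Data.Fin using (Fin)
open import Data.Product using (Σ; _×_; ∃; _,_)
open import Relation.Nullary using (¬_)
open import Relation.Unary using (Pred)
open import Relation.Binary.PropositionalEquality using (_≡_)
open import Algebra.Bundles using (Group)
open import Algebra.Bundles.Raw using (RawGroup)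

FiniteGroup : ∀ {c ℓ} → Group c ℓ → Set (c ⊔ ℓ)
FiniteGroup G = Σ ℕ λ m → Σ (Fin m → Carrier) λ f → ∀ g → Σ (Fin m) λ i → f i ≈ g
  where open Group G

record IsNormalSubgroup {c ℓ p} (H : RawGroup c ℓ) (N : Pred (RawGroup.Carrier H) p)
       : Set (c ⊔ ℓ ⊔ p) where
  open RawGroup H
  field
    resp   : ∀ {g h} → g ≈ h → N g → N h
    ε∈     : N ε
    ∙-closed : ∀ {g h} → N g → N h → N (g ∙ h)
    ⁻¹-closed : ∀ {g} → N g → N (g ⁻¹)
    conj-closed : ∀ g {h} → N h → N ((g ∙ h) ∙ (g ⁻¹))

NonTrivial : ∀ {c ℓ p} (H : RawGroup c ℓ) → Pred (RawGroup.Carrier H) p → Set (c ⊔ ℓ ⊔ p)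
NonTrivial H N = Σ Carrier λ g → N g × ¬ (g ≈ ε)
  where open RawGroup H

record Action {c ℓ} (G : Group c ℓ) (n : ℕ) : Set (c ⊔ ℓ) where
  open Group G
  field
    act      : Carrier → Fin n → Fin n
    act-resp : ∀ {g h} x → g ≈ h → act g x ≡ act h x
    act-ε    : ∀ x → act ε x ≡ x
    act-∙    : ∀ g h x → act (g ∙ h) x ≡ act g (act h x)

module _ {c ℓ} {G : Group c ℓ} {n : ℕ} (A : Action G n) where
  open Group G
  open Action A

  -- y lies in the G-orbit of x (the orbit X_i is represented by any point x of it)
  InOrbit : Fin n → Fin n → Set c
  InOrbit x y = Σ Carrier λ g → act g x ≡ y

  SameOrbit : Fin n → Fin n → Set c
  SameOrbit x y = InOrbit x y

  TransitiveOn : ∀ {p} → Pred Carrier p → Fin n → Set (c ⊔ p)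
  TransitiveOn S x = ∀ y z → InOrbit x y → InOrbit x z →
                     Σ Carrier λ g → S g × act g y ≡ z

  Faithful : Fin n → Set (c ⊔ ℓ)
  Faithful x = ∀ g → (∀ y → InOrbit x y → act g y ≡ y) → g ≈ ε

  -- the induced group G^{X_i} on the orbit X_i of x: the elements of G,
  -- identified when they induce the same permutation of X_i
  Induced : Fin n → RawGroup c c
  Induced x = record
    { Carrier = Carrier
    ; _≈_ = λ g h → ∀ y → InOrbit x y → act g y ≡ act h y
    ; _∙_ = _∙_
    ; ε = ε
    ; _⁻¹ = _⁻¹
    }

  Quasiprimitive : Fin n → Set (Level.suc (c ⊔ ℓ))
  Quasiprimitive x = (M : Pred Carrier (c ⊔ ℓ)) →
    IsNormalSubgroup (Induced x) M → NonTrivial (Induced x) M → TransitiveOn M x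

-- Suppose x and y lie in different orbits, both G-faithful, and G is quasiprimitive on
-- neither. A witness against quasiprimitivity on X_x yields a nontrivial normal subgroup N
-- of G that is intransitive on X_x (the normal closure of a nontrivial element of the
-- offending subgroup of G^{X_x}); likewise N′ intransitive on X_y. The hypothesis then
-- forces N to be transitive on X_y, N′ on X_x, and N ∩ N′ = 1, so N and N′ commute.
-- By faithfulness N′ acts semiregularly on X_y and N on X_x, so h x ↦ h y (h ∈ N′) and
-- g y ↦ g x (g ∈ N) are injections X_x → X_y → X_x. Their composite is onto, hence every
-- point of X_x is g x for some g ∈ N: N is transitive on X_x after all.
module Submission where

open import Defs
open import Level using (0ℓ; _⊔_; Lift; lift)
open import Algebra.Bundles using (Group)
open import Algebra.Bundles.Raw using (RawGroup)
import Algebra.Properties.Group as GroupProperties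
open import Data.Bool using (Bool; true; false; not)
open import Data.Empty using (⊥)
open import Data.Fin using (Fin; toℕ; punchOut)
open import Data.Fin.Properties
  using (_≟_; any?; all?; pigeonhole; injective⇒≤; punchOut-injective; toℕ<n)
open import Data.List using (List; []; _∷_; _++_; [_]; map; reverse; foldr; length; take; drop)
open import Data.List.Properties using (unfold-reverse; length-++; length-take; length-drop; take++drop≡id)
open import Data.Nat using (ℕ; zero; suc; _+_; _∸_; _⊓_; _≤_; _<_; z≤n; s≤s)
open import Data.Nat.Induction using (<-wellFounded)
open import Data.Nat.Properties
  using (_≤?_; ≰⇒>; m<n⇒m<1+n; 1+n≰n; ≤-pred; m⊓n≤m; +-monoˡ-≤; +-monoˡ-<; m+[n∸m]≡n; module ≤-Reasoning)
open import Data.Product using (∃; ∃₂; _×_; _,_; proj₁; proj₂)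
open import Data.Sum using (inj₁; inj₂)
open import Function using (_∘_)
open import Function.Definitions using (Injective; StrictlySurjective)
open import Induction.WellFounded using (Acc; acc)
open import Relation.Nullary using (¬_; Dec; yes; no; contradiction)
open import Relation.Nullary.Decidable using (map′; _⊎-dec_; _→-dec_; decidable-stable)
open import Relation.Unary using (Pred; Decidable; _⊆_; _∩_)
open import Relation.Binary.PropositionalEquality using (_≡_; refl; sym; trans; cong; cong₂; subst; module ≡-Reasoning)

injective⇒surjective : ∀ {n} {f : Fin n → Fin n} → Injective _≡_ _≡_ f → StrictlySurjective _≡_ f
injective⇒surjective {suc n} {f} f-injective w with any? (λ u → f u ≟ w)
... | yes hit = hit
... | no miss = contradiction (injective⇒≤ f-avoiding-w-injective) 1+n≰n
  where
  f-avoiding-w : Fin (suc n) → Fin n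
  f-avoiding-w u = punchOut {i = w} (λ w≡fu → miss (u , sym w≡fu))

  f-avoiding-w-injective : Injective _≡_ _≡_ f-avoiding-w
  f-avoiding-w-injective {u} {u′} =
    f-injective ∘ punchOut-injective (λ e → miss (u , sym e)) (λ e → miss (u′ , sym e))

injective-on⇒surjective-on :
  ∀ {n p} {P : Pred (Fin n) p} → Decidable P →
  (φ : ∀ u → P u → Fin n) → (∀ u pu → P (φ u pu)) →
  (∀ {u u′} pu pu′ → φ u pu ≡ φ u′ pu′ → u ≡ u′) →
  ∀ {w} → P w → ∃₂ λ u (pu : P u) → φ u pu ≡ w
injective-on⇒surjective-on {n} {P = P} P? φ φ-into φ-injective {w} pw =
  let u , Φu≡w = injective⇒surjective Φ-injective w in preimage (P? u) Φu≡w
  where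
  extend : ∀ u → Dec (P u) → Fin n
  extend u (yes pu) = φ u pu
  extend u (no _)   = u

  extend-injective : ∀ {u u′} (d : Dec (P u)) (d′ : Dec (P u′)) → extend u d ≡ extend u′ d′ → u ≡ u′
  extend-injective (yes pu)  (yes pu′)  e = φ-injective pu pu′ e
  extend-injective (yes pu)  (no ¬pu′)  e = contradiction (subst P e (φ-into _ pu)) ¬pu′
  extend-injective (no ¬pu)  (yes pu′)  e = contradiction (subst P (sym e) (φ-into _ pu′)) ¬pu
  extend-injective (no _)    (no _)     e = e

  Φ-injective : Injective _≡_ _≡_ (λ u → extend u (P? u))
  Φ-injective {u} {u′} = extend-injective (P? u) (P? u′)

  preimage : ∀ {u} (d : Dec (P u)) → extend u d ≡ w → ∃₂ λ u (pu : P u) → φ u pu ≡ w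
  preimage (yes pu) e = _ , pu , e
  preimage (no ¬pu) e = contradiction (subst P (sym e) pw) ¬pu

module Words {C : Set} (search : (P : Pred C 0ℓ) → Decidable P → Dec (∃ P))
             {n : ℕ} (step : C → Fin n → Fin n) where

  run : List C → Fin n → Fin n
  run []      u = u
  run (c ∷ w) u = step c (run w u)

  run-++ : ∀ w w′ u → run (w ++ w′) u ≡ run w (run w′ u)
  run-++ []      w′ u = refl
  run-++ (c ∷ w) w′ u = cong (step c) (run-++ w w′ u)

  run-map : (τ : C → C) (σ : Fin n → Fin n) → (∀ c u → step (τ c) (σ u) ≡ σ (step c u)) →
            ∀ w u → run (map τ w) (σ u) ≡ σ (run w u)
  run-map τ σ intertwines []      u = refl
  run-map τ σ intertwines (c ∷ w) u =
    trans (cong (step (τ c)) (run-map τ σ intertwines w u)) (intertwines c (run w u))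

  run-reverse-map : (flip : C → C) → (∀ c u → step (flip c) (step c u) ≡ u) →
                    ∀ w u → run (reverse (map flip w)) (run w u) ≡ u
  run-reverse-map flip cancel []      u = refl
  run-reverse-map flip cancel (c ∷ w) u = begin
    run (reverse (map flip (c ∷ w))) (step c (run w u))
      ≡⟨ cong (λ v → run v (step c (run w u))) (unfold-reverse (flip c) (map flip w)) ⟩
    run (reverse (map flip w) ++ [ flip c ]) (step c (run w u))
      ≡⟨ run-++ (reverse (map flip w)) [ flip c ] _ ⟩
    run (reverse (map flip w)) (step (flip c) (step c (run w u)))
      ≡⟨ cong (run (reverse (map flip w))) (cancel c (run w u)) ⟩
    run (reverse (map flip w)) (run w u)
      ≡⟨ run-reverse-map flip cancel w u ⟩
    u ∎
    where open ≡-Reasoning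

  cut-loop : ∀ {a b} w u → a < b → b ≤ length w → run (drop a w) u ≡ run (drop b w) u →
             length (take a w ++ drop b w) < length w × run (take a w ++ drop b w) u ≡ run w u
  cut-loop {a} {b} w u a<b b≤|w| loop = shorter , same-run
    where
    shorter : length (take a w ++ drop b w) < length w
    shorter = begin-strict
      length (take a w ++ drop b w)             ≡⟨ length-++ (take a w) ⟩
      length (take a w) + length (drop b w)     ≡⟨ cong₂ _+_ (length-take a w) (length-drop b w) ⟩
      a ⊓ length w + (length w ∸ b)             ≤⟨ +-monoˡ-≤ (length w ∸ b) (m⊓n≤m a (length w)) ⟩
      a + (length w ∸ b)                        <⟨ +-monoˡ-< (length w ∸ b) a<b ⟩
      b + (length w ∸ b)                        ≡⟨ m+[n∸m]≡n b≤|w| ⟩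
      length w                                  ∎
      where open ≤-Reasoning

    same-run : run (take a w ++ drop b w) u ≡ run w u
    same-run = begin
      run (take a w ++ drop b w) u         ≡⟨ run-++ (take a w) (drop b w) u ⟩
      run (take a w) (run (drop b w) u)    ≡⟨ cong (run (take a w)) (sym loop) ⟩
      run (take a w) (run (drop a w) u)    ≡⟨ sym (run-++ (take a w) (drop a w) u) ⟩
      run (take a w ++ drop a w) u         ≡⟨ cong (λ v → run v u) (take++drop≡id a w) ⟩
      run w u                              ∎
      where open ≡-Reasoning

  -- A word longer than n visits some point twice along its run.
  remove-loop : ∀ w u → n < length w → ∃ λ w′ → length w′ < length w × run w′ u ≡ run w u
  remove-loop w u n<|w|
    with i , j , i<j , loop ← pigeonhole (m<n⇒m<1+n n<|w|) (λ (k : Fin (suc (length w))) → run (drop (toℕ k) w) u)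
    = take (toℕ i) w ++ drop (toℕ j) w , cut-loop w u i<j (≤-pred (toℕ<n j)) loop

  shorten : ∀ w u → ∃ λ w′ → length w′ ≤ n × run w′ u ≡ run w u
  shorten w u = go w (<-wellFounded (length w))
    where
    go : ∀ w → Acc _<_ (length w) → ∃ λ w′ → length w′ ≤ n × run w′ u ≡ run w u
    go w (acc rec) with length w ≤? n
    ... | yes |w|≤n = w , |w|≤n , refl
    ... | no  |w|≰n =
      let w′ , shorter , same = remove-loop w u (≰⇒> |w|≰n)
          w″ , bounded , same′ = go w′ (rec shorter)
      in w″ , bounded , trans same′ same

  bounded? : ∀ k (P : Pred (List C) 0ℓ) → Decidable P → Dec (∃ λ w → length w ≤ k × P w)
  bounded? zero P P? = map′ (λ p → [] , z≤n , p) (λ { ([] , _ , p) → p }) (P? [])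
  bounded? (suc k) P P? =
    map′ from to (P? [] ⊎-dec search _ (λ c → bounded? k (P ∘ (c ∷_)) (P? ∘ (c ∷_))))
    where
    from : _ → ∃ λ w → length w ≤ suc k × P w
    from (inj₁ p)               = [] , z≤n , p
    from (inj₂ (c , w , l , p)) = c ∷ w , s≤s l , p
    to : ∃ (λ w → length w ≤ suc k × P w) → _
    to ([] , _ , p)          = inj₁ p
    to (c ∷ w , s≤s l , p)   = inj₂ (c , w , l , p)

  Reachable : Fin n → Fin n → Set
  Reachable u v = ∃ λ w → run w u ≡ v

  reachable? : ∀ u v → Dec (Reachable u v)
  reachable? u v =
    map′ (λ (w , _ , e) → w , e)
         (λ (w , e) → let w′ , l , e′ = shorten w u in w′ , l , trans e′ e)
         (bounded? n (λ w → run w u ≡ v) (λ w → run w u ≟ v))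

∩-normal : ∀ {c ℓ p q} {H : RawGroup c ℓ} {N : Pred (RawGroup.Carrier H) p} {N′ : Pred (RawGroup.Carrier H) q} →
           IsNormalSubgroup H N → IsNormalSubgroup H N′ → IsNormalSubgroup H (N ∩ N′)
∩-normal N-normal N′-normal = record
  { resp        = λ e (a , b) → N.resp e a , N′.resp e b
  ; ε∈          = N.ε∈ , N′.ε∈
  ; ∙-closed    = λ (a , b) (a′ , b′) → N.∙-closed a a′ , N′.∙-closed b b′
  ; ⁻¹-closed   = λ (a , b) → N.⁻¹-closed a , N′.⁻¹-closed b
  ; conj-closed = λ g (a , b) → N.conj-closed g a , N′.conj-closed g b
  }
  where
  module N  = IsNormalSubgroup N-normal
  module N′ = IsNormalSubgroup N′-normal

module ActionProperties {c ℓ} {G : Group c ℓ} {n : ℕ} (A : Action G n) where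
  open Group G hiding (refl; sym; trans)
  open Group G using () renaming (sym to ≈-sym; trans to ≈-trans)
  open Action A
  open GroupProperties G using (ε⁻¹≈ε)
  open ≡-Reasoning

  act-⁻¹ˡ : ∀ g u → act (g ⁻¹) (act g u) ≡ u
  act-⁻¹ˡ g u = trans (sym (act-∙ (g ⁻¹) g u)) (trans (act-resp u (inverseˡ g)) (act-ε u))

  act-⁻¹ʳ : ∀ g u → act g (act (g ⁻¹) u) ≡ u
  act-⁻¹ʳ g u = trans (sym (act-∙ g (g ⁻¹) u)) (trans (act-resp u (inverseʳ g)) (act-ε u))

  act-≈ε : ∀ {g} → g ≈ ε → ∀ u → act g u ≡ u
  act-≈ε g≈ε u = trans (act-resp u g≈ε) (act-ε u)

  act-conj : ∀ a b u → act ((a ∙ b) ∙ a ⁻¹) u ≡ act a (act b (act (a ⁻¹) u))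
  act-conj a b u = trans (act-∙ (a ∙ b) (a ⁻¹) u) (act-∙ a b _)

  act-conj-∙ : ∀ {f′} g f p u → f′ ≈ g ∙ f →
               act ((f′ ∙ p) ∙ f′ ⁻¹) (act g u) ≡ act g (act ((f ∙ p) ∙ f ⁻¹) u)
  act-conj-∙ {f′} g f p u f′≈gf = begin
    act ((f′ ∙ p) ∙ f′ ⁻¹) (act g u)         ≡⟨ act-conj f′ p _ ⟩
    act f′ (act p (act (f′ ⁻¹) (act g u)))  ≡⟨ cong (λ v → act f′ (act p v)) f′⁻¹g≡f⁻¹ ⟩
    act f′ (act p (act (f ⁻¹) u))           ≡⟨ act-resp _ f′≈gf ⟩
    act (g ∙ f) (act p (act (f ⁻¹) u))      ≡⟨ act-∙ g f _ ⟩
    act g (act f (act p (act (f ⁻¹) u)))    ≡⟨ cong (act g) (sym (act-conj f p u)) ⟩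
    act g (act ((f ∙ p) ∙ f ⁻¹) u)          ∎
    where
    f′f⁻¹≡g : act f′ (act (f ⁻¹) u) ≡ act g u
    f′f⁻¹≡g = trans (act-resp _ f′≈gf) (trans (act-∙ g f _) (cong (act g) (act-⁻¹ʳ f u)))

    f′⁻¹g≡f⁻¹ : act (f′ ⁻¹) (act g u) ≡ act (f ⁻¹) u
    f′⁻¹g≡f⁻¹ = trans (cong (act (f′ ⁻¹)) (sym f′f⁻¹≡g)) (act-⁻¹ˡ f′ _)

  act-conj-ε : ∀ {f} p u → f ≈ ε → act ((f ∙ p) ∙ f ⁻¹) u ≡ act p u
  act-conj-ε {f} p u f≈ε = begin
    act ((f ∙ p) ∙ f ⁻¹) u        ≡⟨ act-conj f p u ⟩
    act f (act p (act (f ⁻¹) u))  ≡⟨ act-≈ε f≈ε _ ⟩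
    act p (act (f ⁻¹) u)          ≡⟨ cong (act p) (act-≈ε (≈-trans (⁻¹-cong f≈ε) ε⁻¹≈ε) u) ⟩
    act p u                       ∎

  act-commutator : ∀ a b u → act (((a ∙ b) ∙ a ⁻¹) ∙ b ⁻¹) (act b (act a u)) ≡ act a (act b u)
  act-commutator a b u = begin
    act (((a ∙ b) ∙ a ⁻¹) ∙ b ⁻¹) (act b (act a u))  ≡⟨ act-∙ _ (b ⁻¹) _ ⟩
    act ((a ∙ b) ∙ a ⁻¹) (act (b ⁻¹) (act b (act a u))) ≡⟨ cong (act _) (act-⁻¹ˡ b _) ⟩
    act ((a ∙ b) ∙ a ⁻¹) (act a u)                     ≡⟨ act-conj a b _ ⟩
    act a (act b (act (a ⁻¹) (act a u)))               ≡⟨ cong (act a ∘ act b) (act-⁻¹ˡ a u) ⟩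
    act a (act b u)                                    ∎

  inOrbit-refl : ∀ x → InOrbit A x x
  inOrbit-refl x = ε , act-ε x

  TransitiveOn-mono : ∀ {p q} {S : Pred Carrier p} {S′ : Pred Carrier q} {z} →
                      S ⊆ S′ → TransitiveOn A S z → TransitiveOn A S′ z
  TransitiveOn-mono S⊆S′ S-transitive u v ou ov =
    let g , g∈S , gu≡v = S-transitive u v ou ov in g , S⊆S′ g∈S , gu≡v

  reachesOrbit⇒transitiveOn :
    ∀ {p} {S : Pred Carrier p} {z} →
    (∀ {g h} → S g → S h → S (g ∙ h)) → (∀ {g} → S g → S (g ⁻¹)) →
    (∀ v → InOrbit A z v → ∃ λ g → S g × act g z ≡ v) → TransitiveOn A S z
  reachesOrbit⇒transitiveOn {z = z} ∙-closed ⁻¹-closed reaches u v ou ov =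
    let g , g∈S , gz≡u = reaches u ou
        h , h∈S , hz≡v = reaches v ov
    in h ∙ g ⁻¹ , ∙-closed h∈S (⁻¹-closed g∈S) , (begin
      act (h ∙ g ⁻¹) u          ≡⟨ act-∙ h (g ⁻¹) u ⟩
      act h (act (g ⁻¹) u)      ≡⟨ cong (act h ∘ act (g ⁻¹)) (sym gz≡u) ⟩
      act h (act (g ⁻¹) (act g z)) ≡⟨ cong (act h) (act-⁻¹ˡ g z) ⟩
      act h z                   ≡⟨ hz≡v ⟩
      v                         ∎)

  normal-subgroups-commute :
    ∀ {p q} {N : Pred Carrier p} {N′ : Pred Carrier q} →
    IsNormalSubgroup rawGroup N → IsNormalSubgroup rawGroup N′ →
    (∀ {g} → (N ∩ N′) g → ¬ ¬ (g ≈ ε)) →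
    ∀ {a b} → N a → N′ b → ∀ u → act a (act b u) ≡ act b (act a u)
  normal-subgroups-commute {N = N} {N′} N-normal N′-normal meet-trivial {a} {b} a∈N b∈N′ u =
    decidable-stable (act a (act b u) ≟ act b (act a u)) λ noncommuting →
      meet-trivial ([a,b]∈N , [a,b]∈N′) λ [a,b]≈ε →
        noncommuting (trans (sym (act-commutator a b u)) (act-≈ε [a,b]≈ε _))
    where
    module N  = IsNormalSubgroup N-normal
    module N′ = IsNormalSubgroup N′-normal

    [a,b]∈N′ : N′ (((a ∙ b) ∙ a ⁻¹) ∙ b ⁻¹)
    [a,b]∈N′ = N′.∙-closed (N′.conj-closed a b∈N′) (N′.⁻¹-closed b∈N′)

    [a,b]∈N : N (((a ∙ b) ∙ a ⁻¹) ∙ b ⁻¹)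
    [a,b]∈N = N.resp reassociate (N.∙-closed a∈N (N.conj-closed b (N.⁻¹-closed a∈N)))
      where
      reassociate : a ∙ ((b ∙ a ⁻¹) ∙ b ⁻¹) ≈ ((a ∙ b) ∙ a ⁻¹) ∙ b ⁻¹
      reassociate = ≈-sym (≈-trans (assoc (a ∙ b) (a ⁻¹) (b ⁻¹))
                          (≈-trans (assoc a b (a ⁻¹ ∙ b ⁻¹)) (∙-congˡ (≈-sym (assoc b (a ⁻¹) (b ⁻¹))))))

  Semiregular : ∀ {p} → Pred Carrier p → Fin n → Set (c ⊔ ℓ ⊔ p)
  Semiregular K z = ∀ {k} → K k → act k z ≡ z → k ≈ ε

  semiregular-if-centralizes-transitive :
    ∀ {p q} {T : Pred Carrier p} {K : Pred Carrier q} {z} →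
    Faithful A z → TransitiveOn A T z →
    (∀ {g k} → T g → K k → ∀ u → act g (act k u) ≡ act k (act g u)) → Semiregular K z
  semiregular-if-centralizes-transitive {z = z} z-faithful T-transitive centralizes {k} k∈K kz≡z =
    z-faithful k λ v ov →
      let g , g∈T , gz≡v = T-transitive z v (inOrbit-refl z) ov in begin
        act k v          ≡⟨ cong (act k) (sym gz≡v) ⟩
        act k (act g z)  ≡⟨ sym (centralizes g∈T k∈K z) ⟩
        act g (act k z)  ≡⟨ cong (act g) kz≡z ⟩
        act g z          ≡⟨ gz≡v ⟩
        v                ∎

  semiregular-agree :
    ∀ {p} {K : Pred Carrier p} {z} → IsNormalSubgroup rawGroup K → Semiregular K z →
    ∀ {h h′} → K h → K h′ → act h z ≡ act h′ z → ∀ u → act h u ≡ act h′ u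
  semiregular-agree {z = z} K-normal K-semiregular {h} {h′} h∈K h′∈K hz≡h′z u = sym (begin
    act h′ u                             ≡⟨ sym (act-⁻¹ʳ h _) ⟩
    act h (act (h ⁻¹) (act h′ u))        ≡⟨ cong (act h) (sym (act-∙ (h ⁻¹) h′ u)) ⟩
    act h (act (h ⁻¹ ∙ h′) u)            ≡⟨ cong (act h) (act-≈ε h⁻¹h′≈ε u) ⟩
    act h u                              ∎)
    where
    module K = IsNormalSubgroup K-normal

    h⁻¹h′≈ε : h ⁻¹ ∙ h′ ≈ ε
    h⁻¹h′≈ε = K-semiregular (K.∙-closed (K.⁻¹-closed h∈K) h′∈K)
      (trans (act-∙ (h ⁻¹) h′ z) (trans (cong (act (h ⁻¹)) (sym hz≡h′z)) (act-⁻¹ˡ h z)))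

  module Carry {p} {K : Pred Carrier p} (K-normal : IsNormalSubgroup rawGroup K) {x y : Fin n}
               (K-transitive : TransitiveOn A K x) (K-semiregular : Semiregular K y) where

    mover : ∀ u → InOrbit A x u → ∃ λ h → K h × act h x ≡ u
    mover u ou = K-transitive x u (inOrbit-refl x) ou

    carry : ∀ u → InOrbit A x u → Fin n
    carry u ou = act (proj₁ (mover u ou)) y

    carry-inOrbit : ∀ u ou → InOrbit A y (carry u ou)
    carry-inOrbit u ou = proj₁ (mover u ou) , refl

    carry-injective : ∀ {u u′} ou ou′ → carry u ou ≡ carry u′ ou′ → u ≡ u′
    carry-injective {u} {u′} ou ou′ e =
      let h  , h∈K  , hx≡u   = mover u ou
          h′ , h′∈K , h′x≡u′ = mover u′ ou′
      in trans (sym hx≡u) (trans (semiregular-agree K-normal K-semiregular h∈K h′∈K e x) h′x≡u′)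

module FiniteAction {c ℓ} {G : Group c ℓ} (finite : FiniteGroup G) {n : ℕ} (A : Action G n) where
  open Group G hiding (refl; sym; trans)
  open Action A
  open ActionProperties A
  open ≡-Reasoning

  m : ℕ
  m = proj₁ finite

  element : Fin m → Carrier
  element = proj₁ (proj₂ finite)

  index : Carrier → Fin m
  index g = proj₁ (proj₂ (proj₂ finite) g)

  element-index : ∀ g → element (index g) ≈ g
  element-index g = proj₂ (proj₂ (proj₂ finite) g)

  inOrbit? : ∀ x y → Dec (InOrbit A x y)
  inOrbit? x y =
    map′ (λ (i , e) → element i , e)
         (λ (g , e) → index g , trans (act-resp x (element-index g)) e)
         (any? (λ i → act (element i) x ≟ y))

  transitive-by-exchange :
    ∀ {p q} {N : Pred Carrier p} {K : Pred Carrier q} {x y} →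
    IsNormalSubgroup rawGroup N → IsNormalSubgroup rawGroup K →
    TransitiveOn A N y → Semiregular N x → TransitiveOn A K x → Semiregular K y →
    TransitiveOn A N x
  transitive-by-exchange {N = N} {x = x} N-normal K-normal N-transitive N-semiregular K-transitive K-semiregular =
    reachesOrbit⇒transitiveOn N.∙-closed N.⁻¹-closed reaches
    where
    module N = IsNormalSubgroup N-normal
    module α = Carry K-normal K-transitive K-semiregular
    module β = Carry N-normal N-transitive N-semiregular

    round-trip : ∀ u → InOrbit A x u → Fin n
    round-trip u ou = β.carry (α.carry u ou) (α.carry-inOrbit u ou)

    reaches : ∀ w → InOrbit A x w → ∃ λ g → N g × act g x ≡ w
    reaches w ow =
      let u , ou , round-trip≡w = injective-on⇒surjective-on (inOrbit? x) round-trip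
            (λ u ou → β.carry-inOrbit _ _)
            (λ ou ou′ e → α.carry-injective ou ou′ (β.carry-injective _ _ e)) ow
          g , g∈N , _ = β.mover (α.carry u ou) (α.carry-inOrbit u ou)
      in g , g∈N , round-trip≡w

  AtMostOneIntransitiveOrbit : Set (Level.suc (c ⊔ ℓ))
  AtMostOneIntransitiveOrbit =
    (N : Pred Carrier (c ⊔ ℓ)) → IsNormalSubgroup rawGroup N → NonTrivial rawGroup N →
    ∀ x y → ¬ TransitiveOn A N x → ¬ TransitiveOn A N y → SameOrbit A x y

  no-intransitive-pair :
    AtMostOneIntransitiveOrbit → ∀ {x y} → ¬ SameOrbit A x y → Faithful A x → Faithful A y →
    ∀ {N N′ : Pred Carrier (c ⊔ ℓ)} →
    IsNormalSubgroup rawGroup N → IsNormalSubgroup rawGroup N′ →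
    NonTrivial rawGroup N → NonTrivial rawGroup N′ →
    ¬ TransitiveOn A N x → ¬ TransitiveOn A N′ y → ⊥
  no-intransitive-pair H {x} {y} x≁y x-faithful y-faithful {N} {N′}
                       N-normal N′-normal N-nontrivial N′-nontrivial ¬N-on-x ¬N′-on-y =
    N-transitive-on-y λ N-on-y → N′-transitive-on-x λ N′-on-x →
      ¬N-on-x (transitive-by-exchange N-normal N′-normal N-on-y
        (semiregular-if-centralizes-transitive x-faithful N′-on-x (λ g∈N′ k∈N → sym ∘ commute k∈N g∈N′))
        N′-on-x
        (semiregular-if-centralizes-transitive y-faithful N-on-y commute))
    where
    N-transitive-on-y : ¬ ¬ TransitiveOn A N y
    N-transitive-on-y ¬N-on-y = x≁y (H N N-normal N-nontrivial x y ¬N-on-x ¬N-on-y)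

    N′-transitive-on-x : ¬ ¬ TransitiveOn A N′ x
    N′-transitive-on-x ¬N′-on-x = x≁y (H N′ N′-normal N′-nontrivial x y ¬N′-on-x ¬N′-on-y)

    meet-trivial : ∀ {g} → (N ∩ N′) g → ¬ ¬ (g ≈ ε)
    meet-trivial {g} g∈N∩N′ g≉ε =
      x≁y (H (N ∩ N′) (∩-normal N-normal N′-normal) (g , g∈N∩N′ , g≉ε) x y
             (¬N-on-x ∘ TransitiveOn-mono proj₁) (¬N′-on-y ∘ TransitiveOn-mono proj₂))

    commute : ∀ {a b} → N a → N′ b → ∀ u → act a (act b u) ≡ act b (act a u)
    commute = normal-subgroups-commute N-normal N′-normal meet-trivial

  Generator : Set
  Generator = Bool × Fin m

  search-Generator : (P : Pred Generator 0ℓ) → Decidable P → Dec (∃ P)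
  search-Generator P P? =
    map′ from to (any? (P? ∘ (true ,_)) ⊎-dec any? (P? ∘ (false ,_)))
    where
    from : _ → ∃ P
    from (inj₁ (i , p)) = (true , i) , p
    from (inj₂ (i , p)) = (false , i) , p
    to : ∃ P → _
    to ((true  , i) , p) = inj₁ (i , p)
    to ((false , i) , p) = inj₂ (i , p)

  module NormalClosure (g₀ : Carrier) where

    power : Bool → Carrier
    power true  = g₀
    power false = g₀ ⁻¹

    generator : Generator → Carrier
    generator (b , i) = (element i ∙ power b) ∙ element i ⁻¹

    open Words search-Generator (λ c → act (generator c))

    eval : List Generator → Carrier
    eval = foldr (λ c g → generator c ∙ g) ε

    act-eval : ∀ w u → act (eval w) u ≡ run w u
    act-eval []      u = act-ε u
    act-eval (c ∷ w) u = trans (act-∙ (generator c) (eval w) u) (cong (act (generator c)) (act-eval w u))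

    -- The elements acting on X as some product of conjugates of g₀^{±1}: the normal closure
    -- of g₀ times the kernel of the action. Defining it through the action on points is what
    -- makes its transitivity on an orbit decidable (see reachesOrbit?).
    Closure : Pred Carrier (c ⊔ ℓ)
    Closure g = Lift (c ⊔ ℓ) (∃ λ w → ∀ u → act g u ≡ run w u)

    invert : Generator → Generator
    invert (b , i) = not b , i

    act-power-cancel : ∀ b u → act (power (not b)) (act (power b) u) ≡ u
    act-power-cancel true  = act-⁻¹ˡ g₀
    act-power-cancel false = act-⁻¹ʳ g₀

    act-generator-cancel : ∀ c u → act (generator (invert c)) (act (generator c) u) ≡ u
    act-generator-cancel (b , i) u = begin
      act (conj (not b)) (act (conj b) u)
        ≡⟨ act-conj f (power (not b)) _ ⟩
      act f (act (power (not b)) (act (f ⁻¹) (act (conj b) u)))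
        ≡⟨ cong (λ v → act f (act (power (not b)) (act (f ⁻¹) v))) (act-conj f (power b) u) ⟩
      act f (act (power (not b)) (act (f ⁻¹) (act f (act (power b) (act (f ⁻¹) u)))))
        ≡⟨ cong (act f ∘ act (power (not b))) (act-⁻¹ˡ f _) ⟩
      act f (act (power (not b)) (act (power b) (act (f ⁻¹) u)))
        ≡⟨ cong (act f) (act-power-cancel b _) ⟩
      act f (act (f ⁻¹) u)
        ≡⟨ act-⁻¹ʳ f u ⟩
      u ∎
      where
      f = element i
      conj : Bool → Carrier
      conj b′ = generator (b′ , i)

    shift : Carrier → Generator → Generator
    shift g (b , i) = b , index (g ∙ element i)

    Closure-normal : IsNormalSubgroup rawGroup Closure
    Closure-normal = record
      { resp        = λ { g≈h (lift (w , g↦w)) → lift (w , λ u → trans (sym (act-resp u g≈h)) (g↦w u)) }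
      ; ε∈          = lift ([] , act-ε)
      ; ∙-closed    = λ { (lift g∈) (lift h∈) → lift (∙-word g∈ h∈) }
      ; ⁻¹-closed   = λ { (lift g∈) → lift (⁻¹-word g∈) }
      ; conj-closed = λ { g (lift h∈) → lift (conj-word g h∈) }
      }
      where
      ∙-word : ∀ {g h} → (∃ λ w → ∀ u → act g u ≡ run w u) → (∃ λ w → ∀ u → act h u ≡ run w u) →
               ∃ λ w → ∀ u → act (g ∙ h) u ≡ run w u
      ∙-word {g} {h} (w , g↦w) (w′ , h↦w′) = w ++ w′ , λ u → begin
        act (g ∙ h) u     ≡⟨ act-∙ g h u ⟩
        act g (act h u)   ≡⟨ cong (act g) (h↦w′ u) ⟩
        act g (run w′ u)  ≡⟨ g↦w _ ⟩
        run w (run w′ u)  ≡⟨ sym (run-++ w w′ u) ⟩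
        run (w ++ w′) u   ∎

      ⁻¹-word : ∀ {g} → (∃ λ w → ∀ u → act g u ≡ run w u) → ∃ λ w → ∀ u → act (g ⁻¹) u ≡ run w u
      ⁻¹-word {g} (w , g↦w) = w⁻¹ , λ u → begin
        act (g ⁻¹) u                     ≡⟨ sym (run-reverse-map invert act-generator-cancel w _) ⟩
        run w⁻¹ (run w (act (g ⁻¹) u))   ≡⟨ cong (run w⁻¹) (sym (g↦w _)) ⟩
        run w⁻¹ (act g (act (g ⁻¹) u))   ≡⟨ cong (run w⁻¹) (act-⁻¹ʳ g u) ⟩
        run w⁻¹ u                        ∎
        where w⁻¹ = reverse (map invert w)

      conj-word : ∀ g {h} → (∃ λ w → ∀ u → act h u ≡ run w u) →
                  ∃ λ w → ∀ u → act ((g ∙ h) ∙ g ⁻¹) u ≡ run w u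
      conj-word g {h} (w , h↦w) = map (shift g) w , λ u → begin
        act ((g ∙ h) ∙ g ⁻¹) u                   ≡⟨ act-conj g h u ⟩
        act g (act h (act (g ⁻¹) u))             ≡⟨ cong (act g) (h↦w _) ⟩
        act g (run w (act (g ⁻¹) u))             ≡⟨ sym (run-map (shift g) (act g) intertwines w _) ⟩
        run (map (shift g) w) (act g (act (g ⁻¹) u)) ≡⟨ cong (run (map (shift g) w)) (act-⁻¹ʳ g u) ⟩
        run (map (shift g) w) u                  ∎
        where
        intertwines : ∀ c u → act (generator (shift g c)) (act g u) ≡ act g (act (generator c) u)
        intertwines (b , i) u = act-conj-∙ g (element i) (power b) u (element-index (g ∙ element i))

    g₀∈Closure : Closure g₀
    g₀∈Closure = lift ([ true , index ε ] , λ u → sym (act-conj-ε g₀ u (element-index ε)))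

    eval∈ : ∀ {p z} {M : Pred Carrier p} → IsNormalSubgroup (Induced A z) M → M g₀ → ∀ w → M (eval w)
    eval∈ {M = M} M-normal g₀∈M = go
      where
      open IsNormalSubgroup M-normal
      power∈ : ∀ b → M (power b)
      power∈ true  = g₀∈M
      power∈ false = ⁻¹-closed g₀∈M
      go : ∀ w → M (eval w)
      go []            = ε∈
      go ((b , i) ∷ w) = ∙-closed (conj-closed (element i) (power∈ b)) (go w)

    ReachesOrbit : Fin n → Set c
    ReachesOrbit z = ∀ v → InOrbit A z v → Reachable z v

    reachesOrbit? : ∀ z → Dec (ReachesOrbit z)
    reachesOrbit? z = all? (λ v → inOrbit? z v →-dec reachable? z v)

    transitiveOn-if-reachesOrbit :
      ∀ {p z} {M : Pred Carrier p} → IsNormalSubgroup (Induced A z) M → M g₀ →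
      ReachesOrbit z → TransitiveOn A M z
    transitiveOn-if-reachesOrbit {z = z} M-normal g₀∈M reach =
      reachesOrbit⇒transitiveOn M.∙-closed M.⁻¹-closed λ v ov →
        let w , run≡v = reach v ov in eval w , eval∈ M-normal g₀∈M w , trans (act-eval w z) run≡v
      where module M = IsNormalSubgroup M-normal

    reachesOrbit-if-transitiveOn : ∀ {z} → TransitiveOn A Closure z → ReachesOrbit z
    reachesOrbit-if-transitiveOn {z} Closure-transitive v ov =
      let g , lift (w , g↦w) , gz≡v = Closure-transitive z v (inOrbit-refl z) ov
      in w , trans (sym (g↦w z)) gz≡v

  quasiprimitive-if-normal-subgroups-transitive :
    ∀ z → ((N : Pred Carrier (c ⊔ ℓ)) → IsNormalSubgroup rawGroup N → NonTrivial rawGroup N →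
           ¬ ¬ TransitiveOn A N z) →
    Quasiprimitive A z
  quasiprimitive-if-normal-subgroups-transitive z normal-transitive M M-normal (g₀ , g₀∈M , g₀-moves) =
    transitiveOn-if-reachesOrbit M-normal g₀∈M
      (decidable-stable (reachesOrbit? z) λ ¬reaches →
        normal-transitive Closure Closure-normal (g₀ , g₀∈Closure , g₀≉ε)
          (¬reaches ∘ reachesOrbit-if-transitiveOn))
    where
    open NormalClosure g₀
    g₀≉ε : ¬ g₀ ≈ ε
    g₀≉ε g₀≈ε = g₀-moves λ y _ → act-resp y g₀≈ε

lemma2p2 : ∀ {c ℓ} (G : Group c ℓ) → FiniteGroup G → (n : ℕ) (A : Action G n) →
    ((N : Pred (Group.Carrier G) (c ⊔ ℓ)) →
    IsNormalSubgroup (Group.rawGroup G) N → NonTrivial (Group.rawGroup G) N →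
    ∀ x y → ¬ TransitiveOn A N x → ¬ TransitiveOn A N y → SameOrbit A x y) →
    ∀ x y → Faithful A x → Faithful A y →
    ¬ Quasiprimitive A x → ¬ Quasiprimitive A y → SameOrbit A x y
lemma2p2 G finite n A H x y x-faithful y-faithful ¬quasiprimitive-x ¬quasiprimitive-y =
  decidable-stable (inOrbit? x y) λ x≁y →
    ¬quasiprimitive-x (quasiprimitive-if-normal-subgroups-transitive x λ N N-normal N-nontrivial ¬N-on-x →
      ¬quasiprimitive-y (quasiprimitive-if-normal-subgroups-transitive y λ N′ N′-normal N′-nontrivial ¬N′-on-y →
        no-intransitive-pair H x≁y x-faithful y-faithful
          N-normal N′-normal N-nontrivial N′-nontrivial ¬N-on-x ¬N′-on-y))
  where open FiniteAction finite A
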